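{- Every finite projective plane is super-neat: if $D$ is a $2$-$(q^2+q+1,q+1,1)$ design (a projective plane of order $q\geq 2$), then every minimum dominating set of the incidence graph of $D$ is neat.
   Context: A $2$-$(v,k,\lambda)$ design $D=(X,\mathcal{B})$ consists of a set $X$ of $v$ points and a family $\mathcal{B}$ of $k$-subsets (blocks) such that every pair of distinct points lies in exactly $\lambda$ blocks. The incidence graph $G_D$ has vertex set $X\cup\mathcal{B}$ with $x$ adjacent to $B$ iff $x\in B$. A dominating set is a set $S$ of vertices such that every vertex not in $S$ is adjacent to some vertex of $S$; $\gamma(D)$ is the minimum size of a dominating set of $G_D$, and a minimum dominating set is one of size $\gamma(D)$. For $P\subseteq X$, $\hat{L}(P)=\{B\in\mathcal{B}:B\cap P=\emptyset\}$ and $I_P=P\cup\hat{L}(P)$. A set $S$ is neat if $S=I_P$ for some $P\subseteq X$. $D$ is super-neat if every minimum dominating set of $G_D$ is neat. -}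

module Defs where

open import Data.Nat using (ℕ; _+_; _≤_; _≥_; _≡ᵇ_)
open import Data.Bool using (Bool; true; false; _∧_; not)
open import Data.Fin using (Fin)
open import Data.Fin.Subset using (Subset; ∣_∣; _∈_; _∉_; _∩_)
open import Data.Vec using (lookup; tabulate)
open import Data.Product using (Σ; _×_; ∃; _,_; proj₁; proj₂)
open import Data.Sum using (_⊎_)
open import Relation.Binary.PropositionalEquality using (_≡_)
open import Relation.Nullary using (¬_)

-- A finite incidence structure: v points (Fin v) and a family of b blocks
-- (indexed by Fin b, repetitions allowed), each block a subset of the points.

pairCount : ∀ {v b} → (Fin b → Subset v) → Fin v → Fin v → ℕ
pairCount blk x y = ∣ tabulate (λ j → lookup (blk j) x ∧ lookup (blk j) y) ∣

record Is2Design (v k lam b : ℕ) (blk : Fin b → Subset v) : Set where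
  field
    blockSize : ∀ j → ∣ blk j ∣ ≡ k
    pairs     : ∀ x y → ¬ (x ≡ y) → pairCount blk x y ≡ lam

-- A vertex set of the incidence graph G_D: a set of points and a set of blocks.
VSet : ℕ → ℕ → Set
VSet v b = Subset v × Subset b

size : ∀ {v b} → VSet v b → ℕ
size (P , Q) = ∣ P ∣ + ∣ Q ∣

record Dominating {v b} (blk : Fin b → Subset v) (S : VSet v b) : Set where
  constructor dom
  field
    pointsDom : ∀ (x : Fin v) → x ∉ proj₁ S →
                ∃ λ (j : Fin b) → (j ∈ proj₂ S) × (x ∈ blk j)
    blocksDom : ∀ (j : Fin b) → j ∉ proj₂ S →
                ∃ λ (x : Fin v) → (x ∈ proj₁ S) × (x ∈ blk j)

record MinDominating {v b} (blk : Fin b → Subset v) (S : VSet v b) : Set where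
  field
    isDom   : Dominating blk S
    minimal : ∀ (T : VSet v b) → Dominating blk T → size S ≤ size T

disjointBlocks : ∀ {v b} → (Fin b → Subset v) → Subset v → Subset b
disjointBlocks blk P = tabulate (λ j → ∣ blk j ∩ P ∣ ≡ᵇ 0)

I : ∀ {v b} → (Fin b → Subset v) → Subset v → VSet v b
I blk P = P , disjointBlocks blk P

Neat : ∀ {v b} → (Fin b → Subset v) → VSet v b → Set
Neat {v} blk S = ∃ λ (P : Subset v) → S ≡ I blk P

SuperNeat : ∀ {v b} → (Fin b → Subset v) → Set
SuperNeat {v} {b} blk = ∀ (S : VSet v b) → MinDominating blk S → Neat blk S

-- A plane of order q has a dominating set of size 2q: the points of a line ℓ other than a
-- point r, together with the lines through r other than ℓ. Conversely, a dominating set (P, Q)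
-- in which some line ℓ ∈ Q meets P in a point y₀ has at least 2q + 1 vertices. If |P| ≤ q,
-- count lines: each is in Q or meets P, ℓ is counted twice, and at most 1 + |P| q lines meet P
-- (the q + 1 through y₀, and q more through each other point of P). If |P| > q, count points:
-- each point outside P lies on a line of Q, which covers at most q + 1 of them, and ℓ at most q.
-- So in a minimum dominating set no line of Q meets P, and every line outside Q meets P by
-- domination; that is, Q is exactly the set of lines disjoint from P.

module Submission where

open import Defs
open import Data.Nat using (ℕ; _+_; _*_; _≥_)
open import Data.Fin using (Fin)
open import Data.Fin.Subset using (Subset)

open import Data.Nat using (zero; suc; _≤_; _<_; _≤?_; z≤n; s≤s; z<s; s≤s⁻¹; NonZero; >-nonZero; >-nonZero⁻¹; _≡ᵇ_)
open import Data.Nat.Properties hiding (_≟_)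
open import Data.Nat.Tactic.RingSolver using (solve-∀)
open import Algebra.Properties.CommutativeSemigroup +-commutativeSemigroup using (x∙yz≈y∙xz)
open import Algebra.Properties.Semiring.Sum +-*-semiring
  using (sum; sum-syntax; sum-cong-≗; ∑-distrib-+; ∑-comm; *-distribˡ-sum; *-distribʳ-sum)
open import Data.Bool using (Bool; true; false; _∧_; not; T)
open import Data.Unit using (tt)
open import Data.Fin using (zero; suc; fromℕ<)
open import Data.Fin.Properties using (_≟_)
open import Data.Fin.Subset using (_∈_; _∉_; _⊆_; _∩_; _-_; ∣_∣; Nonempty; inside; outside)
open import Data.Fin.Subset.Properties
  using (_∈?_; nonempty?; Empty-unique; ∣⊥∣≡0; p─⊥≡p; x∈p∩q⁺; x∈p∩q⁻; x∈p∧x≢y⇒x∈p-y; p─q⊆p; ⊆-antisym)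
open import Data.Vec using ([]; _∷_; lookup; tabulate; here; there)
open import Data.Vec.Properties using (lookup∘tabulate; lookup-zipWith; []=⇒lookup; lookup⇒[]=)
open import Data.Product using (∃; ∃₂; _,_; _×_)
open import Function using (_∘_)
open import Relation.Binary.PropositionalEquality
open import Relation.Nullary using (yes; no; does; contradiction)
open import Relation.Nullary.Decidable using (dec-true; dec-false)

𝟙 : Bool → ℕ
𝟙 true  = 1
𝟙 false = 0

⟦_∈_⟧ : ∀ {n} → Fin n → Subset n → ℕ
⟦ x ∈ p ⟧ = 𝟙 (lookup p x)

⟦_∉_⟧ : ∀ {n} → Fin n → Subset n → ℕ
⟦ x ∉ p ⟧ = 𝟙 (not (lookup p x))

⟦_≢_⟧ : ∀ {n} → Fin n → Fin n → ℕ
⟦ x ≢ y ⟧ = 𝟙 (not (does (x ≟ y)))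

𝟙-∧ : ∀ a c → 𝟙 (a ∧ c) ≡ 𝟙 a * 𝟙 c
𝟙-∧ true  true  = refl
𝟙-∧ true  false = refl
𝟙-∧ false _     = refl

𝟙≤1 : ∀ a → 𝟙 a ≤ 1
𝟙≤1 true  = s≤s z≤n
𝟙≤1 false = z≤n

𝟙+𝟙∘not≡1 : ∀ a → 𝟙 a + 𝟙 (not a) ≡ 1
𝟙+𝟙∘not≡1 true  = refl
𝟙+𝟙∘not≡1 false = refl

m*n>0⇒m>0×n>0 : ∀ m n → 0 < m * n → 0 < m × 0 < n
m*n>0⇒m>0×n>0 m n m*n>0 =
  let instance _ = >-nonZero m*n>0
  in >-nonZero⁻¹ m {{m*n≢0⇒m≢0 m}} , >-nonZero⁻¹ n {{m*n≢0⇒n≢0 m}}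

module _ {n} {p : Subset n} {x : Fin n} where

  ∉⇒lookup≡false : x ∉ p → lookup p x ≡ false
  ∉⇒lookup≡false x∉p with lookup p x in eq
  ... | true  = contradiction (lookup⇒[]= x p eq) x∉p
  ... | false = refl

  ∈⇒⟦∈⟧≡1 : x ∈ p → ⟦ x ∈ p ⟧ ≡ 1
  ∈⇒⟦∈⟧≡1 x∈p = cong 𝟙 ([]=⇒lookup x∈p)

  ∉⇒⟦∈⟧≡0 : x ∉ p → ⟦ x ∈ p ⟧ ≡ 0
  ∉⇒⟦∈⟧≡0 x∉p = cong 𝟙 (∉⇒lookup≡false x∉p)

  ∈⇒⟦∉⟧≡0 : x ∈ p → ⟦ x ∉ p ⟧ ≡ 0
  ∈⇒⟦∉⟧≡0 x∈p = cong (𝟙 ∘ not) ([]=⇒lookup x∈p)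

  ∉⇒⟦∉⟧≡1 : x ∉ p → ⟦ x ∉ p ⟧ ≡ 1
  ∉⇒⟦∉⟧≡1 x∉p = cong (𝟙 ∘ not) (∉⇒lookup≡false x∉p)

  ⟦∈⟧>0⇒∈ : 0 < ⟦ x ∈ p ⟧ → x ∈ p
  ⟦∈⟧>0⇒∈ ⟦x∈p⟧>0 with lookup p x in eq
  ... | true = lookup⇒[]= x p eq

⟦≢⟧-refl : ∀ {n} (x : Fin n) → ⟦ x ≢ x ⟧ ≡ 0
⟦≢⟧-refl x = cong (𝟙 ∘ not) (dec-true (x ≟ x) refl)

≢⇒⟦≢⟧≡1 : ∀ {n} {x y : Fin n} → x ≢ y → ⟦ x ≢ y ⟧ ≡ 1
≢⇒⟦≢⟧≡1 {x = x} {y} x≢y = cong (𝟙 ∘ not) (dec-false (x ≟ y) x≢y)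

⟦≢⟧>0⇒≢ : ∀ {n} {x y : Fin n} → 0 < ⟦ x ≢ y ⟧ → x ≢ y
⟦≢⟧>0⇒≢ {x = x} ⟦x≢y⟧>0 refl = <-irrefl (sym (⟦≢⟧-refl x)) ⟦x≢y⟧>0

sum-const : ∀ n c → ∑[ i < n ] c ≡ n * c
sum-const zero    c = refl
sum-const (suc n) c = cong (c +_) (sum-const n c)

sum-mono-≤ : ∀ {n} {f g : Fin n → ℕ} → (∀ i → f i ≤ g i) → sum f ≤ sum g
sum-mono-≤ {zero}  f≤g = z≤n
sum-mono-≤ {suc n} f≤g = +-mono-≤ (f≤g zero) (sum-mono-≤ (f≤g ∘ suc))

sum-pos⇒∃ : ∀ {n} (f : Fin n → ℕ) → 0 < sum f → ∃ λ i → 0 < f i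
sum-pos⇒∃ {suc n} f ∑f>0 with f zero in eq
... | suc _ = zero , subst (0 <_) (sym eq) z<s
... | zero  = let i , fi>0 = sum-pos⇒∃ (f ∘ suc) ∑f>0 in suc i , fi>0

sum-pick : ∀ {n} (f : Fin n → ℕ) x → sum f ≡ f x + ∑[ y < n ] (f y * ⟦ y ≢ x ⟧)
sum-pick {suc n} f zero =
  cong (f zero +_) (cong₂ _+_ (sym (*-zeroʳ (f zero))) (sum-cong-≗ λ y → sym (*-identityʳ (f (suc y)))))
sum-pick {suc n} f (suc x) = begin
  f zero + sum (f ∘ suc)                 ≡⟨ cong (f zero +_) (sum-pick (f ∘ suc) x) ⟩
  f zero + (f (suc x) + rest)            ≡⟨ x∙yz≈y∙xz (f zero) (f (suc x)) rest ⟩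
  f (suc x) + (f zero + rest)            ≡⟨ cong (λ m → f (suc x) + (m + rest)) (sym (*-identityʳ (f zero))) ⟩
  f (suc x) + (f zero * 1 + rest)        ∎
  where
  open ≡-Reasoning
  rest = ∑[ y < n ] (f (suc y) * ⟦ y ≢ x ⟧)

term≤sum : ∀ {n} (f : Fin n → ℕ) x → f x ≤ sum f
term≤sum f x = subst (f x ≤_) (sym (sum-pick f x)) (m≤m+n (f x) _)

sum-mono-< : ∀ {n} {f g : Fin n → ℕ} x → (∀ i → f i ≤ g i) → f x < g x → sum f < sum g
sum-mono-< {f = f} {g} x f≤g fx<gx = subst₂ _<_ (sym (sum-pick f x)) (sym (sum-pick g x))
  (+-mono-<-≤ fx<gx (sum-mono-≤ λ y → *-monoˡ-≤ ⟦ y ≢ x ⟧ (f≤g y)))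

two-terms≤sum : ∀ {n} (f : Fin n → ℕ) {x y} → x ≢ y → f x + f y ≤ sum f
two-terms≤sum {n} f {x} {y} x≢y = begin
  f x + f y                              ≡⟨ cong (f x +_) (sym f-y-counted) ⟩
  f x + f y * ⟦ y ≢ x ⟧                  ≤⟨ +-monoʳ-≤ (f x) (term≤sum (λ z → f z * ⟦ z ≢ x ⟧) y) ⟩
  f x + ∑[ z < n ] (f z * ⟦ z ≢ x ⟧)     ≡⟨ sum-pick f x ⟨
  sum f                                  ∎
  where
  open ≤-Reasoning
  f-y-counted : f y * ⟦ y ≢ x ⟧ ≡ f y
  f-y-counted = trans (cong (f y *_) (≢⇒⟦≢⟧≡1 (x≢y ∘ sym))) (*-identityʳ (f y))

sum-split : ∀ {n} (f : Fin n → ℕ) (g : Fin n → Bool) →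
            ∑[ i < n ] (f i * 𝟙 (g i)) + ∑[ i < n ] (f i * 𝟙 (not (g i))) ≡ sum f
sum-split f g = trans (sym (∑-distrib-+ (λ i → f i * 𝟙 (g i)) (λ i → f i * 𝟙 (not (g i)))))
  (sum-cong-≗ λ i → trans (sym (*-distribˡ-+ (f i) _ _))
    (trans (cong (f i *_) (𝟙+𝟙∘not≡1 (g i))) (*-identityʳ (f i))))

∣p∣≡∑ : ∀ {n} (p : Subset n) → ∣ p ∣ ≡ ∑[ x < n ] ⟦ x ∈ p ⟧
∣p∣≡∑ []            = refl
∣p∣≡∑ (inside  ∷ p) = cong suc (∣p∣≡∑ p)
∣p∣≡∑ (outside ∷ p) = ∣p∣≡∑ p

∣p∣+∑⟦∉p⟧≡n : ∀ {n} (p : Subset n) → ∣ p ∣ + ∑[ x < n ] ⟦ x ∉ p ⟧ ≡ n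
∣p∣+∑⟦∉p⟧≡n []            = refl
∣p∣+∑⟦∉p⟧≡n (inside  ∷ p) = cong suc (∣p∣+∑⟦∉p⟧≡n p)
∣p∣+∑⟦∉p⟧≡n (outside ∷ p) = trans (+-suc ∣ p ∣ _) (cong suc (∣p∣+∑⟦∉p⟧≡n p))

∣p∩q∣≡∑ : ∀ {n} (p q : Subset n) → ∣ p ∩ q ∣ ≡ ∑[ x < n ] (⟦ x ∈ p ⟧ * ⟦ x ∈ q ⟧)
∣p∩q∣≡∑ p q = trans (∣p∣≡∑ (p ∩ q)) (sum-cong-≗ λ x →
  trans (cong 𝟙 (lookup-zipWith _∧_ x p q)) (𝟙-∧ (lookup p x) (lookup q x)))

∈⇒∣p∣>0 : ∀ {n} {p : Subset n} {x} → x ∈ p → 0 < ∣ p ∣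
∈⇒∣p∣>0 {p = p} {x} x∈p =
  subst₂ _≤_ (∈⇒⟦∈⟧≡1 x∈p) (sym (∣p∣≡∑ p)) (term≤sum (λ y → ⟦ y ∈ p ⟧) x)

∣p∣>0⇒Nonempty : ∀ {n} {p : Subset n} → 0 < ∣ p ∣ → Nonempty p
∣p∣>0⇒Nonempty {n} {p} ∣p∣>0 with nonempty? p
... | yes p-nonempty = p-nonempty
... | no  p-empty    = contradiction (trans (cong ∣_∣ (Empty-unique p-empty)) (∣⊥∣≡0 n)) (n>0⇒n≢0 ∣p∣>0)

suc∣p-x∣≡∣p∣ : ∀ {n} {p : Subset n} {x} → x ∈ p → suc ∣ p - x ∣ ≡ ∣ p ∣
suc∣p-x∣≡∣p∣ {p = inside  ∷ p} here        = cong (suc ∘ ∣_∣) (p─⊥≡p p)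
suc∣p-x∣≡∣p∣ {p = inside  ∷ p} (there x∈p) = cong suc (suc∣p-x∣≡∣p∣ x∈p)
suc∣p-x∣≡∣p∣ {p = outside ∷ p} (there x∈p) = suc∣p-x∣≡∣p∣ x∈p

two-members : ∀ {n} {p : Subset n} → 2 ≤ ∣ p ∣ → ∃₂ λ y z → y ≢ z × y ∈ p × z ∈ p
two-members {n} {p} 2≤∣p∣ =
  let y , y∈p      = ∣p∣>0⇒Nonempty (≤-trans (s≤s z≤n) 2≤∣p∣)
      z , z-other  = sum-pos⇒∃ (λ z → ⟦ z ∈ p ⟧ * ⟦ z ≢ y ⟧) (others>0 y∈p)
      z∈p , z≢y    = m*n>0⇒m>0×n>0 ⟦ z ∈ p ⟧ ⟦ z ≢ y ⟧ z-other
  in y , z , (λ y≡z → ⟦≢⟧>0⇒≢ z≢y (sym y≡z)) , y∈p , ⟦∈⟧>0⇒∈ z∈p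
  where
  others>0 : ∀ {y} → y ∈ p → 0 < ∑[ z < n ] (⟦ z ∈ p ⟧ * ⟦ z ≢ y ⟧)
  others>0 {y} y∈p = s≤s⁻¹ (subst (2 ≤_) ∣p∣≡1+others 2≤∣p∣)
    where
    others = ∑[ z < n ] (⟦ z ∈ p ⟧ * ⟦ z ≢ y ⟧)
    ∣p∣≡1+others : ∣ p ∣ ≡ 1 + others
    ∣p∣≡1+others = trans (∣p∣≡∑ p) (trans (sum-pick (λ z → ⟦ z ∈ p ⟧) y) (cong (_+ others) (∈⇒⟦∈⟧≡1 y∈p)))

few-points-arith : ∀ {q a c} .{{_ : NonZero q}} → a ≤ q → q * q + q + 1 ≤ c + a * q → q + q < a + c
few-points-arith {a = a} {c} a≤q bound with m≤n⇒∃[o]m+o≡n a≤q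
... | d , refl = begin
  suc (q + q)                       ≡⟨ double a d ⟩
  a + (d + (q + 1))                 ≤⟨ +-monoʳ-≤ a (+-monoˡ-≤ (q + 1) (m≤m*n d q)) ⟩
  a + (d * q + (q + 1))             ≤⟨ +-monoʳ-≤ a (+-cancelʳ-≤ (a * q) _ c (subst (_≤ c + a * q) (square a d) bound)) ⟩
  a + c                             ∎
  where
  open ≤-Reasoning
  q = a + d
  double : ∀ a d → suc ((a + d) + (a + d)) ≡ a + (d + ((a + d) + 1))
  double = solve-∀
  square : ∀ a d → (a + d) * (a + d) + (a + d) + 1 ≡ d * (a + d) + ((a + d) + 1) + a * (a + d)
  square = solve-∀

many-points-arith : ∀ {q a c} → q < a → q * q + q + 1 < a + c * suc q → q + q < a + c
many-points-arith q<a bound = ≰⇒> λ a+c≤q+q → <⇒≱ bound (small-bound q<a a+c≤q+q)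
  where
  shift : ∀ q t c → suc q + t + c ≡ q + suc (t + c)
  shift = solve-∀
  square : ∀ t c e → let s = t + c + e in
    suc s * suc s + suc s + 1 ≡ (suc (suc s) + t + c * suc (suc s)) + (s * t + s * e + t + 2 * e + 1)
  square = solve-∀
  small-bound : ∀ {q a c} → q < a → a + c ≤ q + q → a + c * suc q ≤ q * q + q + 1
  small-bound {q} {a} {c} q<a a+c≤q+q with m≤n⇒∃[o]m+o≡n q<a
  ... | t , refl with m≤n⇒∃[o]m+o≡n (+-cancelˡ-≤ q (suc (t + c)) q (subst (_≤ q + q) (shift q t c) a+c≤q+q))
  ...   | e , refl = subst (lhs ≤_) (sym (square t c e)) (m≤m+n lhs (s * t + s * e + t + 2 * e + 1))
    where
    s = t + c + e
    lhs = suc (suc s) + t + c * suc (suc s)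

module Incidence {v b : ℕ} (blk : Fin b → Subset v) where

  meets⇒∉disjointBlocks : ∀ {P j x} → x ∈ blk j → x ∈ P → j ∉ disjointBlocks blk P
  meets⇒∉disjointBlocks {P} {j} x∈j x∈P j∈D =
    n>0⇒n≢0 (∈⇒∣p∣>0 (x∈p∩q⁺ (x∈j , x∈P))) (≡ᵇ⇒≡ ∣ blk j ∩ P ∣ 0 (subst T (sym disjoint) tt))
    where
    disjoint : (∣ blk j ∩ P ∣ ≡ᵇ 0) ≡ true
    disjoint = trans (sym (lookup∘tabulate _ j)) ([]=⇒lookup j∈D)

  ∉disjointBlocks⇒meets : ∀ {P j} → j ∉ disjointBlocks blk P → ∃ λ x → x ∈ blk j × x ∈ P
  ∉disjointBlocks⇒meets {P} {j} j∉D =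
    let x , x∈j∩P = ∣p∣>0⇒Nonempty (n≢0⇒n>0 (j∉D ∘ disjoint)) in x , x∈p∩q⁻ (blk j) P x∈j∩P
    where
    disjoint : ∣ blk j ∩ P ∣ ≡ 0 → j ∈ disjointBlocks blk P
    disjoint ∣j∩P∣≡0 = lookup⇒[]= j _ (trans (lookup∘tabulate _ j) (cong (_≡ᵇ 0) ∣j∩P∣≡0))

  blocks-covered : ∀ {P Q} → Dominating blk (P , Q) → ∀ {ℓ y} → ℓ ∈ Q → y ∈ blk ℓ → y ∈ P →
                   suc b ≤ ∣ Q ∣ + ∑[ j < b ] ⟦ j ∉ disjointBlocks blk P ⟧
  blocks-covered {P} {Q} (dom _ blocksDom) {ℓ} {y} ℓ∈Q y∈ℓ y∈P = begin
    suc b                                           ≡⟨ cong suc (trans (sym (*-identityʳ b)) (sym (sum-const b 1))) ⟩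
    suc (∑[ j < b ] 1)                              ≤⟨ sum-mono-< ℓ covered (≤-reflexive (sym ℓ-covered-twice)) ⟩
    ∑[ j < b ] (⟦ j ∈ Q ⟧ + ⟦ j ∉ D ⟧)              ≡⟨ ∑-distrib-+ (λ j → ⟦ j ∈ Q ⟧) (λ j → ⟦ j ∉ D ⟧) ⟩
    ∑[ j < b ] ⟦ j ∈ Q ⟧ + ∑[ j < b ] ⟦ j ∉ D ⟧    ≡⟨ cong (_+ ∑[ j < b ] ⟦ j ∉ D ⟧) (∣p∣≡∑ Q) ⟨
    ∣ Q ∣ + ∑[ j < b ] ⟦ j ∉ D ⟧                   ∎
    where
    open ≤-Reasoning
    D = disjointBlocks blk P
    covered : ∀ j → 1 ≤ ⟦ j ∈ Q ⟧ + ⟦ j ∉ D ⟧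
    covered j with j ∈? Q
    ... | yes j∈Q = ≤-trans (≤-reflexive (sym (∈⇒⟦∈⟧≡1 j∈Q))) (m≤m+n _ _)
    ... | no  j∉Q = let x , x∈P , x∈j = blocksDom j j∉Q in
                    ≤-trans (≤-reflexive (sym (∉⇒⟦∉⟧≡1 (meets⇒∉disjointBlocks x∈j x∈P)))) (m≤n+m _ _)
    ℓ-covered-twice : ⟦ ℓ ∈ Q ⟧ + ⟦ ℓ ∉ D ⟧ ≡ 2
    ℓ-covered-twice = cong₂ _+_ (∈⇒⟦∈⟧≡1 ℓ∈Q) (∉⇒⟦∉⟧≡1 (meets⇒∉disjointBlocks y∈ℓ y∈P))

  points-covered : ∀ {P Q} → Dominating blk (P , Q) →
    ∑[ x < v ] ⟦ x ∉ P ⟧ ≤ ∑[ j < b ] (⟦ j ∈ Q ⟧ * ∑[ x < v ] (⟦ x ∈ blk j ⟧ * ⟦ x ∉ P ⟧))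
  points-covered {P} {Q} (dom pointsDom _) = begin
    ∑[ x < v ] ⟦ x ∉ P ⟧                                           ≤⟨ sum-mono-≤ covered ⟩
    ∑[ x < v ] ∑[ j < b ] (⟦ j ∈ Q ⟧ * (⟦ x ∈ blk j ⟧ * ⟦ x ∉ P ⟧))  ≡⟨ ∑-comm (λ x j → ⟦ j ∈ Q ⟧ * (⟦ x ∈ blk j ⟧ * ⟦ x ∉ P ⟧)) ⟩
    ∑[ j < b ] ∑[ x < v ] (⟦ j ∈ Q ⟧ * (⟦ x ∈ blk j ⟧ * ⟦ x ∉ P ⟧))  ≡⟨ sum-cong-≗ (λ j → *-distribˡ-sum ⟦ j ∈ Q ⟧ (λ x → ⟦ x ∈ blk j ⟧ * ⟦ x ∉ P ⟧)) ⟨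
    ∑[ j < b ] (⟦ j ∈ Q ⟧ * ∑[ x < v ] (⟦ x ∈ blk j ⟧ * ⟦ x ∉ P ⟧)) ∎
    where
    open ≤-Reasoning
    covered : ∀ x → ⟦ x ∉ P ⟧ ≤ ∑[ j < b ] (⟦ j ∈ Q ⟧ * (⟦ x ∈ blk j ⟧ * ⟦ x ∉ P ⟧))
    covered x with x ∈? P
    ... | yes x∈P = ≤-trans (≤-reflexive (∈⇒⟦∉⟧≡0 x∈P)) z≤n
    ... | no  x∉P = let j , j∈Q , x∈j = pointsDom x x∉P in begin
      ⟦ x ∉ P ⟧                                     ≡⟨ ∉⇒⟦∉⟧≡1 x∉P ⟩
      1                                              ≡⟨ cong₂ (λ m n → m * (n * 1)) (∈⇒⟦∈⟧≡1 j∈Q) (∈⇒⟦∈⟧≡1 x∈j) ⟨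
      ⟦ j ∈ Q ⟧ * (⟦ x ∈ blk j ⟧ * 1)               ≡⟨ cong (λ m → ⟦ j ∈ Q ⟧ * (⟦ x ∈ blk j ⟧ * m)) (∉⇒⟦∉⟧≡1 x∉P) ⟨
      ⟦ j ∈ Q ⟧ * (⟦ x ∈ blk j ⟧ * ⟦ x ∉ P ⟧)       ≤⟨ term≤sum (λ i → ⟦ i ∈ Q ⟧ * (⟦ x ∈ blk i ⟧ * ⟦ x ∉ P ⟧)) j ⟩
      ∑[ i < b ] (⟦ i ∈ Q ⟧ * (⟦ x ∈ blk i ⟧ * ⟦ x ∉ P ⟧)) ∎

module LinearSpace {v k b : ℕ} {blk : Fin b → Subset v} (D : Is2Design v k 1 b blk) where

  open Is2Design D

  pairs-∑ : ∀ {x y} → x ≢ y → ∑[ j < b ] (⟦ x ∈ blk j ⟧ * ⟦ y ∈ blk j ⟧) ≡ 1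
  pairs-∑ {x} {y} x≢y = trans (sym (trans (∣p∣≡∑ through-both) (sum-cong-≗ on-both))) (pairs x y x≢y)
    where
    through-both : Subset b
    through-both = tabulate (λ i → lookup (blk i) x ∧ lookup (blk i) y)
    on-both : ∀ j → ⟦ j ∈ through-both ⟧ ≡ ⟦ x ∈ blk j ⟧ * ⟦ y ∈ blk j ⟧
    on-both j = trans (cong 𝟙 (lookup∘tabulate _ j)) (𝟙-∧ (lookup (blk j) x) (lookup (blk j) y))

  block-through : ∀ {x y} → x ≢ y → ∃ λ j → x ∈ blk j × y ∈ blk j
  block-through {x} {y} x≢y =
    let j , on-j = sum-pos⇒∃ (λ j → ⟦ x ∈ blk j ⟧ * ⟦ y ∈ blk j ⟧) (≤-reflexive (sym (pairs-∑ x≢y)))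
        x-on-j , y-on-j = m*n>0⇒m>0×n>0 ⟦ x ∈ blk j ⟧ ⟦ y ∈ blk j ⟧ on-j
    in j , ⟦∈⟧>0⇒∈ x-on-j , ⟦∈⟧>0⇒∈ y-on-j

  ∣blkᵢ∩blkⱼ∣≤1 : ∀ {i j} → i ≢ j → ∣ blk i ∩ blk j ∣ ≤ 1
  ∣blkᵢ∩blkⱼ∣≤1 {i} {j} i≢j = ≮⇒≥ λ 1<∣i∩j∣ →
    let y , z , y≢z , y∈i∩j , z∈i∩j = two-members 1<∣i∩j∣
        y∈i , y∈j = x∈p∩q⁻ (blk i) (blk j) y∈i∩j
        z∈i , z∈j = x∈p∩q⁻ (blk i) (blk j) z∈i∩j
        on-both : ∀ {l} → y ∈ blk l → z ∈ blk l → ⟦ y ∈ blk l ⟧ * ⟦ z ∈ blk l ⟧ ≡ 1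
        on-both y∈l z∈l = cong₂ _*_ (∈⇒⟦∈⟧≡1 y∈l) (∈⇒⟦∈⟧≡1 z∈l)
    in 1+n≰n (begin
      2                                                   ≡⟨ cong₂ _+_ (on-both y∈i z∈i) (on-both y∈j z∈j) ⟨
      ⟦ y ∈ blk i ⟧ * ⟦ z ∈ blk i ⟧ + ⟦ y ∈ blk j ⟧ * ⟦ z ∈ blk j ⟧
                                                          ≤⟨ two-terms≤sum (λ l → ⟦ y ∈ blk l ⟧ * ⟦ z ∈ blk l ⟧) i≢j ⟩
      ∑[ l < b ] (⟦ y ∈ blk l ⟧ * ⟦ z ∈ blk l ⟧)          ≡⟨ pairs-∑ y≢z ⟩
      1                                                   ∎)
    where open ≤-Reasoning

  blocks-through-partition : ∀ {x} (w : Fin v → ℕ) → w x ≡ 0 →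
    ∑[ j < b ] (⟦ x ∈ blk j ⟧ * ∑[ y < v ] (⟦ y ∈ blk j ⟧ * w y)) ≡ sum w
  blocks-through-partition {x} w wx≡0 = begin
    ∑[ j < b ] (⟦ x ∈ blk j ⟧ * ∑[ y < v ] (⟦ y ∈ blk j ⟧ * w y))   ≡⟨ sum-cong-≗ (λ j → *-distribˡ-sum ⟦ x ∈ blk j ⟧ (λ y → ⟦ y ∈ blk j ⟧ * w y)) ⟩
    ∑[ j < b ] ∑[ y < v ] (⟦ x ∈ blk j ⟧ * (⟦ y ∈ blk j ⟧ * w y))   ≡⟨ ∑-comm (λ j y → ⟦ x ∈ blk j ⟧ * (⟦ y ∈ blk j ⟧ * w y)) ⟩
    ∑[ y < v ] ∑[ j < b ] (⟦ x ∈ blk j ⟧ * (⟦ y ∈ blk j ⟧ * w y))   ≡⟨ sum-cong-≗ counted-once ⟩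
    sum w                                                              ∎
    where
    open ≡-Reasoning
    counted-once : ∀ y → ∑[ j < b ] (⟦ x ∈ blk j ⟧ * (⟦ y ∈ blk j ⟧ * w y)) ≡ w y
    counted-once y = begin
      ∑[ j < b ] (⟦ x ∈ blk j ⟧ * (⟦ y ∈ blk j ⟧ * w y))   ≡⟨ sum-cong-≗ (λ j → *-assoc ⟦ x ∈ blk j ⟧ _ _) ⟨
      ∑[ j < b ] (⟦ x ∈ blk j ⟧ * ⟦ y ∈ blk j ⟧ * w y)     ≡⟨ *-distribʳ-sum (w y) (λ j → ⟦ x ∈ blk j ⟧ * ⟦ y ∈ blk j ⟧) ⟨
      ∑[ j < b ] (⟦ x ∈ blk j ⟧ * ⟦ y ∈ blk j ⟧) * w y     ≡⟨ weight y ⟩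
      w y                                                  ∎
      where
      weight : ∀ y → ∑[ j < b ] (⟦ x ∈ blk j ⟧ * ⟦ y ∈ blk j ⟧) * w y ≡ w y
      weight y with x ≟ y
      ... | yes refl rewrite wx≡0 = *-zeroʳ (∑[ j < b ] (⟦ y ∈ blk j ⟧ * ⟦ y ∈ blk j ⟧))
      ... | no  x≢y  = trans (cong (_* w y) (pairs-∑ x≢y)) (*-identityˡ (w y))

module ProjectivePlane (q : ℕ) .{{_ : NonZero q}} {b : ℕ} {blk : Fin b → Subset (q * q + q + 1)}
                       (D : Is2Design (q * q + q + 1) (q + 1) 1 b blk) where

  open Is2Design D using (blockSize)
  open Incidence blk
  open LinearSpace D

  V : ℕ
  V = q * q + q + 1

  points-on-block : ∀ j → ∑[ x < V ] ⟦ x ∈ blk j ⟧ ≡ suc q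
  points-on-block j = trans (sym (∣p∣≡∑ (blk j))) (trans (blockSize j) (+-comm q 1))

  other-points-on-block : ∀ {x j} → x ∈ blk j → ∑[ y < V ] (⟦ y ∈ blk j ⟧ * ⟦ y ≢ x ⟧) ≡ q
  other-points-on-block {x} {j} x∈j = suc-injective (begin
    1 + others                  ≡⟨ cong (_+ others) (∈⇒⟦∈⟧≡1 x∈j) ⟨
    ⟦ x ∈ blk j ⟧ + others      ≡⟨ sum-pick (λ y → ⟦ y ∈ blk j ⟧) x ⟨
    ∑[ y < V ] ⟦ y ∈ blk j ⟧    ≡⟨ points-on-block j ⟩
    suc q                       ∎)
    where
    open ≡-Reasoning
    others = ∑[ y < V ] (⟦ y ∈ blk j ⟧ * ⟦ y ≢ x ⟧)

  other-points : ∀ x → ∑[ y < V ] ⟦ y ≢ x ⟧ ≡ q * q + q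
  other-points x = suc-injective (begin
    1 + ∑[ y < V ] ⟦ y ≢ x ⟧          ≡⟨ cong suc (sum-cong-≗ λ y → *-identityˡ ⟦ y ≢ x ⟧) ⟨
    1 + ∑[ y < V ] (1 * ⟦ y ≢ x ⟧)    ≡⟨ sum-pick (λ _ → 1) x ⟨
    ∑[ y < V ] 1                      ≡⟨ sum-const V 1 ⟩
    V * 1                             ≡⟨ *-identityʳ V ⟩
    q * q + q + 1                     ≡⟨ +-comm (q * q + q) 1 ⟩
    suc (q * q + q)                   ∎)
    where open ≡-Reasoning

  blocks-through-point : ∀ x → ∑[ j < b ] ⟦ x ∈ blk j ⟧ ≡ suc q
  blocks-through-point x = *-cancelʳ-≡ _ (suc q) q (begin
    ∑[ j < b ] ⟦ x ∈ blk j ⟧ * q                                          ≡⟨ *-distribʳ-sum q (λ j → ⟦ x ∈ blk j ⟧) ⟩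
    ∑[ j < b ] (⟦ x ∈ blk j ⟧ * q)                                        ≡⟨ sum-cong-≗ others-on-block ⟨
    ∑[ j < b ] (⟦ x ∈ blk j ⟧ * ∑[ y < V ] (⟦ y ∈ blk j ⟧ * ⟦ y ≢ x ⟧))   ≡⟨ blocks-through-partition (λ y → ⟦ y ≢ x ⟧) (⟦≢⟧-refl x) ⟩
    ∑[ y < V ] ⟦ y ≢ x ⟧                                                  ≡⟨ other-points x ⟩
    q * q + q                                                             ≡⟨ +-comm (q * q) q ⟩
    suc q * q                                                             ∎)
    where
    open ≡-Reasoning
    others-on-block : ∀ j → ⟦ x ∈ blk j ⟧ * ∑[ y < V ] (⟦ y ∈ blk j ⟧ * ⟦ y ≢ x ⟧) ≡ ⟦ x ∈ blk j ⟧ * q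
    others-on-block j with x ∈? blk j
    ... | yes x∈j = cong (⟦ x ∈ blk j ⟧ *_) (other-points-on-block x∈j)
    ... | no  x∉j rewrite ∉⇒⟦∈⟧≡0 x∉j = refl

  blocks≡points : b ≡ V
  blocks≡points = *-cancelʳ-≡ b V (suc q) (begin
    b * suc q                              ≡⟨ sum-const b (suc q) ⟨
    ∑[ j < b ] suc q                       ≡⟨ sum-cong-≗ points-on-block ⟨
    ∑[ j < b ] ∑[ x < V ] ⟦ x ∈ blk j ⟧    ≡⟨ ∑-comm (λ j x → ⟦ x ∈ blk j ⟧) ⟩
    ∑[ x < V ] ∑[ j < b ] ⟦ x ∈ blk j ⟧    ≡⟨ sum-cong-≗ blocks-through-point ⟩
    ∑[ x < V ] suc q                       ≡⟨ sum-const V (suc q) ⟩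
    V * suc q                              ∎)
    where open ≡-Reasoning

  blocks-through-y-missing-x : ∀ {x y} → x ≢ y → ∑[ j < b ] (⟦ y ∈ blk j ⟧ * ⟦ x ∉ blk j ⟧) ≡ q
  blocks-through-y-missing-x {x} {y} x≢y = suc-injective (begin
    1 + missing                                                ≡⟨ cong (_+ missing) (pairs-∑ (x≢y ∘ sym)) ⟨
    ∑[ j < b ] (⟦ y ∈ blk j ⟧ * ⟦ x ∈ blk j ⟧) + missing       ≡⟨ sum-split (λ j → ⟦ y ∈ blk j ⟧) (λ j → lookup (blk j) x) ⟩
    ∑[ j < b ] ⟦ y ∈ blk j ⟧                                   ≡⟨ blocks-through-point y ⟩
    suc q                                                      ∎)
    where
    open ≡-Reasoning
    missing = ∑[ j < b ] (⟦ y ∈ blk j ⟧ * ⟦ x ∉ blk j ⟧)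

  blocks-meet : ∀ {r i j} → r ∈ blk i → r ∉ blk j → ∃ λ y → y ∈ blk i × y ∈ blk j
  blocks-meet {r} {i} {j} r∈i r∉j =
    let y , y∈i∩j = ∣p∣>0⇒Nonempty (n≢0⇒n>0 i∩j≢∅) in y , x∈p∩q⁻ (blk i) (blk j) y∈i∩j
    where
    open ≡-Reasoning
    t : Fin b → ℕ
    t l = ⟦ r ∈ blk l ⟧ * ∣ blk l ∩ blk j ∣
    t≤ : ∀ l → t l ≤ ⟦ r ∈ blk l ⟧
    t≤ l with r ∈? blk l
    ... | no  r∉l rewrite ∉⇒⟦∈⟧≡0 r∉l = z≤n
    ... | yes r∈l rewrite ∈⇒⟦∈⟧≡1 r∈l =
      ≤-trans (≤-reflexive (*-identityˡ _)) (∣blkᵢ∩blkⱼ∣≤1 λ { refl → r∉j r∈l })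
    ∑t≡suc-q : sum t ≡ suc q
    ∑t≡suc-q = begin
      sum t                                                                  ≡⟨ sum-cong-≗ (λ l → cong (⟦ r ∈ blk l ⟧ *_) (∣p∩q∣≡∑ (blk l) (blk j))) ⟩
      ∑[ l < b ] (⟦ r ∈ blk l ⟧ * ∑[ y < V ] (⟦ y ∈ blk l ⟧ * ⟦ y ∈ blk j ⟧)) ≡⟨ blocks-through-partition (λ y → ⟦ y ∈ blk j ⟧) (∉⇒⟦∈⟧≡0 r∉j) ⟩
      ∑[ y < V ] ⟦ y ∈ blk j ⟧                                               ≡⟨ points-on-block j ⟩
      suc q                                                                  ∎
    i∩j≢∅ : ∣ blk i ∩ blk j ∣ ≢ 0
    i∩j≢∅ ∣i∩j∣≡0 = <-irrefl (trans ∑t≡suc-q (sym (blocks-through-point r))) (sum-mono-< i t≤ ti<r)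
      where
      ti<r : t i < ⟦ r ∈ blk i ⟧
      ti<r = subst₂ _<_ (sym (cong₂ _*_ (∈⇒⟦∈⟧≡1 r∈i) ∣i∩j∣≡0)) (sym (∈⇒⟦∈⟧≡1 r∈i)) z<s

  meeting-block-through-y₀-or-other : ∀ {P y₀} j →
    ⟦ j ∉ disjointBlocks blk P ⟧ ≤
    ⟦ y₀ ∈ blk j ⟧ + ∑[ y < V ] (⟦ y ∈ P ⟧ * ⟦ y ≢ y₀ ⟧ * (⟦ y ∈ blk j ⟧ * ⟦ y₀ ∉ blk j ⟧))
  meeting-block-through-y₀-or-other {P} {y₀} j with y₀ ∈? blk j
  ... | yes y₀∈j = ≤-trans (𝟙≤1 _) (≤-trans (≤-reflexive (sym (∈⇒⟦∈⟧≡1 y₀∈j))) (m≤m+n _ _))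
  ... | no  y₀∉j with j ∈? disjointBlocks blk P
  ...   | yes j∈D = ≤-trans (≤-reflexive (∈⇒⟦∉⟧≡0 j∈D)) z≤n
  ...   | no  j∉D =
    let y , y∈j , y∈P = ∉disjointBlocks⇒meets j∉D
        counted : ⟦ y ∈ P ⟧ * ⟦ y ≢ y₀ ⟧ * (⟦ y ∈ blk j ⟧ * ⟦ y₀ ∉ blk j ⟧) ≡ 1
        counted = cong₂ _*_ (cong₂ _*_ (∈⇒⟦∈⟧≡1 y∈P) (≢⇒⟦≢⟧≡1 {x = y} {y₀} λ { refl → y₀∉j y∈j }))
                            (cong₂ _*_ (∈⇒⟦∈⟧≡1 y∈j) (∉⇒⟦∉⟧≡1 y₀∉j))
    in ≤-trans (𝟙≤1 _) (≤-trans (≤-reflexive (sym counted))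
         (≤-trans (term≤sum (λ z → ⟦ z ∈ P ⟧ * ⟦ z ≢ y₀ ⟧ * (⟦ z ∈ blk j ⟧ * ⟦ y₀ ∉ blk j ⟧)) y) (m≤n+m _ _)))

  blocks-meeting : ∀ {P y₀} → y₀ ∈ P → ∑[ j < b ] ⟦ j ∉ disjointBlocks blk P ⟧ ≤ 1 + ∣ P ∣ * q
  blocks-meeting {P} {y₀} y₀∈P = begin
    ∑[ j < b ] ⟦ j ∉ disjointBlocks blk P ⟧
      ≤⟨ sum-mono-≤ meeting-block-through-y₀-or-other ⟩
    ∑[ j < b ] (⟦ y₀ ∈ blk j ⟧ + ∑[ y < V ] (w y * m j y))
      ≡⟨ ∑-distrib-+ (λ j → ⟦ y₀ ∈ blk j ⟧) (λ j → ∑[ y < V ] (w y * m j y)) ⟩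
    ∑[ j < b ] ⟦ y₀ ∈ blk j ⟧ + ∑[ j < b ] ∑[ y < V ] (w y * m j y)
      ≡⟨ cong₂ _+_ (blocks-through-point y₀) (∑-comm (λ j y → w y * m j y)) ⟩
    suc q + ∑[ y < V ] ∑[ j < b ] (w y * m j y)
      ≡⟨ cong (suc q +_) (sum-cong-≗ λ y → *-distribˡ-sum (w y) (λ j → m j y)) ⟨
    suc q + ∑[ y < V ] (w y * ∑[ j < b ] m j y)
      ≡⟨ cong (suc q +_) (sum-cong-≗ missing-y₀) ⟩
    suc q + ∑[ y < V ] (w y * q)
      ≡⟨ cong (suc q +_) (*-distribʳ-sum q w) ⟨
    suc q + sum w * q
      ≡⟨ cong (λ a → 1 + a * q) ∣P∣≡1+∑w ⟨
    1 + ∣ P ∣ * q ∎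
    where
    open ≤-Reasoning
    w : Fin V → ℕ
    w y = ⟦ y ∈ P ⟧ * ⟦ y ≢ y₀ ⟧
    m : Fin b → Fin V → ℕ
    m j y = ⟦ y ∈ blk j ⟧ * ⟦ y₀ ∉ blk j ⟧
    ∣P∣≡1+∑w : ∣ P ∣ ≡ 1 + sum w
    ∣P∣≡1+∑w = trans (∣p∣≡∑ P) (trans (sum-pick (λ y → ⟦ y ∈ P ⟧) y₀) (cong (_+ sum w) (∈⇒⟦∈⟧≡1 y₀∈P)))
    missing-y₀ : ∀ y → w y * ∑[ j < b ] m j y ≡ w y * q
    missing-y₀ y with y ≟ y₀
    ... | yes refl rewrite *-zeroʳ ⟦ y ∈ P ⟧ = refl
    -- the `with` has already evaluated ⟦ y ≢ y₀ ⟧ to 1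
    ... | no  y≢y₀ = cong (⟦ y ∈ P ⟧ * 1 *_) (blocks-through-y-missing-x (y≢y₀ ∘ sym))

  covering-capacity : ∀ {P Q ℓ y₀} → ℓ ∈ Q → y₀ ∈ blk ℓ → y₀ ∈ P →
    ∑[ j < b ] (⟦ j ∈ Q ⟧ * ∑[ x < V ] (⟦ x ∈ blk j ⟧ * ⟦ x ∉ P ⟧)) < ∣ Q ∣ * suc q
  covering-capacity {P} {Q} {ℓ} {y₀} ℓ∈Q y₀∈ℓ y₀∈P = begin-strict
    ∑[ j < b ] (⟦ j ∈ Q ⟧ * uncovered j)   <⟨ sum-mono-< ℓ (λ j → *-monoʳ-≤ ⟦ j ∈ Q ⟧ (uncovered≤ j)) ℓ-short ⟩
    ∑[ j < b ] (⟦ j ∈ Q ⟧ * suc q)       ≡⟨ *-distribʳ-sum (suc q) (λ j → ⟦ j ∈ Q ⟧) ⟨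
    ∑[ j < b ] ⟦ j ∈ Q ⟧ * suc q         ≡⟨ cong (_* suc q) (∣p∣≡∑ Q) ⟨
    ∣ Q ∣ * suc q                        ∎
    where
    open ≤-Reasoning
    uncovered : Fin b → ℕ
    uncovered j = ∑[ x < V ] (⟦ x ∈ blk j ⟧ * ⟦ x ∉ P ⟧)
    covered+uncovered : ∀ j → ∑[ x < V ] (⟦ x ∈ blk j ⟧ * ⟦ x ∈ P ⟧) + uncovered j ≡ suc q
    covered+uncovered j = trans (sum-split (λ x → ⟦ x ∈ blk j ⟧) (lookup P)) (points-on-block j)
    uncovered≤ : ∀ j → uncovered j ≤ suc q
    uncovered≤ j = subst (uncovered j ≤_) (covered+uncovered j) (m≤n+m _ _)
    ℓ-meets-P : 1 ≤ ∑[ x < V ] (⟦ x ∈ blk ℓ ⟧ * ⟦ x ∈ P ⟧)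
    ℓ-meets-P = subst (0 <_) (∣p∩q∣≡∑ (blk ℓ) P) (∈⇒∣p∣>0 (x∈p∩q⁺ (y₀∈ℓ , y₀∈P)))
    ℓ-short : ⟦ ℓ ∈ Q ⟧ * uncovered ℓ < ⟦ ℓ ∈ Q ⟧ * suc q
    ℓ-short = subst (λ m → m * uncovered ℓ < m * suc q) (sym (∈⇒⟦∈⟧≡1 ℓ∈Q))
      (*-monoʳ-< 1 (subst (suc (uncovered ℓ) ≤_) (covered+uncovered ℓ) (+-monoˡ-≤ (uncovered ℓ) ℓ-meets-P)))

  lower-bound : ∀ {P Q} → Dominating blk (P , Q) → ∀ {ℓ y₀} → ℓ ∈ Q → y₀ ∈ blk ℓ → y₀ ∈ P →
                q + q < ∣ P ∣ + ∣ Q ∣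
  lower-bound {P} {Q} S-dom {ℓ} {y₀} ℓ∈Q y₀∈ℓ y₀∈P with ∣ P ∣ ≤? q
  ... | yes ∣P∣≤q = few-points-arith ∣P∣≤q (+-cancelˡ-≤ 1 _ _ (begin
    1 + V                                            ≡⟨ cong suc blocks≡points ⟨
    suc b                                            ≤⟨ blocks-covered S-dom ℓ∈Q y₀∈ℓ y₀∈P ⟩
    ∣ Q ∣ + ∑[ j < b ] ⟦ j ∉ disjointBlocks blk P ⟧  ≤⟨ +-monoʳ-≤ ∣ Q ∣ (blocks-meeting y₀∈P) ⟩
    ∣ Q ∣ + (1 + ∣ P ∣ * q)                          ≡⟨ x∙yz≈y∙xz ∣ Q ∣ 1 (∣ P ∣ * q) ⟩
    1 + (∣ Q ∣ + ∣ P ∣ * q)                          ∎))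
    where open ≤-Reasoning
  ... | no  ∣P∣≰q = many-points-arith (≰⇒> ∣P∣≰q) (begin-strict
    V                                                                       ≡⟨ ∣p∣+∑⟦∉p⟧≡n P ⟨
    ∣ P ∣ + ∑[ x < V ] ⟦ x ∉ P ⟧                                            ≤⟨ +-monoʳ-≤ ∣ P ∣ (points-covered S-dom) ⟩
    ∣ P ∣ + ∑[ j < b ] (⟦ j ∈ Q ⟧ * ∑[ x < V ] (⟦ x ∈ blk j ⟧ * ⟦ x ∉ P ⟧))  <⟨ +-monoʳ-< ∣ P ∣ (covering-capacity ℓ∈Q y₀∈ℓ y₀∈P) ⟩
    ∣ P ∣ + ∣ Q ∣ * suc q                                                   ∎)
    where open ≤-Reasoning

  blocksThrough : Fin V → Subset b
  blocksThrough x = tabulate (λ j → lookup (blk j) x)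

  ∈blocksThrough⁺ : ∀ {x j} → x ∈ blk j → j ∈ blocksThrough x
  ∈blocksThrough⁺ {x} {j} x∈j = lookup⇒[]= j (blocksThrough x) (trans (lookup∘tabulate _ j) ([]=⇒lookup x∈j))

  ∈blocksThrough⁻ : ∀ {x j} → j ∈ blocksThrough x → x ∈ blk j
  ∈blocksThrough⁻ {x} {j} j∈ = lookup⇒[]= x (blk j) (trans (sym (lookup∘tabulate _ j)) ([]=⇒lookup j∈))

  ∣blocksThrough∣ : ∀ x → ∣ blocksThrough x ∣ ≡ suc q
  ∣blocksThrough∣ x = trans (∣p∣≡∑ (blocksThrough x))
    (trans (sum-cong-≗ λ j → cong 𝟙 (lookup∘tabulate (λ i → lookup (blk i) x) j)) (blocks-through-point x))

  ∣blk-r∣≡q : ∀ {r ℓ} → r ∈ blk ℓ → ∣ blk ℓ - r ∣ ≡ q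
  ∣blk-r∣≡q {r} {ℓ} r∈ℓ = suc-injective (trans (suc∣p-x∣≡∣p∣ r∈ℓ) (trans (blockSize ℓ) (+-comm q 1)))

  ∣blocksThrough-ℓ∣≡q : ∀ {r ℓ} → r ∈ blk ℓ → ∣ blocksThrough r - ℓ ∣ ≡ q
  ∣blocksThrough-ℓ∣≡q {r} r∈ℓ = suc-injective (trans (suc∣p-x∣≡∣p∣ (∈blocksThrough⁺ r∈ℓ)) (∣blocksThrough∣ r))

  star-dominates : ∀ {r ℓ} → r ∈ blk ℓ → Dominating blk (blk ℓ - r , blocksThrough r - ℓ)
  star-dominates {r} {ℓ} r∈ℓ = dom points blocks
    where
    nonempty : ∀ {n} {p : Subset n} → ∣ p ∣ ≡ q → Nonempty p
    nonempty ∣p∣≡q = ∣p∣>0⇒Nonempty (subst (0 <_) (sym ∣p∣≡q) (>-nonZero⁻¹ q))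
    points : ∀ x → x ∉ blk ℓ - r → ∃ λ j → j ∈ blocksThrough r - ℓ × x ∈ blk j
    points x x∉P with x ≟ r
    ... | yes refl = let j , j∈Q = nonempty (∣blocksThrough-ℓ∣≡q r∈ℓ) in
                     j , j∈Q , ∈blocksThrough⁻ (p─q⊆p _ _ j∈Q)
    ... | no  x≢r  = let j , x∈j , r∈j = block-through x≢r in
                     j , x∈p∧x≢y⇒x∈p-y (∈blocksThrough⁺ r∈j) (λ { refl → x∉P (x∈p∧x≢y⇒x∈p-y x∈j x≢r) }) , x∈j
    meets-ℓ-off-r : ∀ {j} → r ∉ blk j → ∃ λ x → x ∈ blk ℓ - r × x ∈ blk j
    meets-ℓ-off-r r∉j with blocks-meet r∈ℓ r∉j
    ... | y , y∈ℓ , y∈j = y , x∈p∧x≢y⇒x∈p-y y∈ℓ (λ { refl → r∉j y∈j }) , y∈j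
    blocks : ∀ j → j ∉ blocksThrough r - ℓ → ∃ λ x → x ∈ blk ℓ - r × x ∈ blk j
    blocks j j∉Q with j ≟ ℓ
    ... | yes refl = let x , x∈P = nonempty (∣blk-r∣≡q r∈ℓ) in x , x∈P , p─q⊆p _ _ x∈P
    ... | no  j≢ℓ  = meets-ℓ-off-r (λ r∈j → j∉Q (x∈p∧x≢y⇒x∈p-y (∈blocksThrough⁺ r∈j) j≢ℓ))

  dominating-set-of-size-2q : ∃ λ T → Dominating blk T × size T ≡ q + q
  dominating-set-of-size-2q =
    let r = fromℕ< (m≤n+m 1 (q * q + q))
        ℓ , ℓ∈ = ∣p∣>0⇒Nonempty (subst (0 <_) (sym (∣blocksThrough∣ r)) z<s)
        r∈ℓ = ∈blocksThrough⁻ ℓ∈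
    in (blk ℓ - r , blocksThrough r - ℓ) , star-dominates r∈ℓ ,
       cong₂ _+_ (∣blk-r∣≡q r∈ℓ) (∣blocksThrough-ℓ∣≡q r∈ℓ)

  superNeat : SuperNeat blk
  superNeat (P , Q) S-min = P , cong (P ,_) (⊆-antisym Q⊆D D⊆Q)
    where
    open MinDominating S-min
    Q⊆D : Q ⊆ disjointBlocks blk P
    Q⊆D {j} j∈Q with j ∈? disjointBlocks blk P
    ... | yes j∈D = j∈D
    ... | no  j∉D =
      let y , y∈j , y∈P = ∉disjointBlocks⇒meets j∉D
          T , T-dom , ∣T∣≡2q = dominating-set-of-size-2q
      in contradiction (≤-trans (minimal T T-dom) (≤-reflexive ∣T∣≡2q)) (<⇒≱ (lower-bound isDom j∈Q y∈j y∈P))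
    D⊆Q : disjointBlocks blk P ⊆ Q
    D⊆Q {j} j∈D with j ∈? Q
    ... | yes j∈Q = j∈Q
    ... | no  j∉Q = let x , x∈P , x∈j = Dominating.blocksDom isDom j j∉Q in
                    contradiction j∈D (meets⇒∉disjointBlocks x∈j x∈P)

theorem4p2 : ∀ (q b : ℕ) → q ≥ 2 → (blk : Fin b → Subset (q * q + q + 1)) →
    Is2Design (q * q + q + 1) (q + 1) 1 b blk → SuperNeat blk
theorem4p2 q b q≥2 blk D = ProjectivePlane.superNeat q {{>-nonZero (≤-trans (s≤s z≤n) q≥2)}} D
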